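{- Let $N$ be a staircase Kunz nilsemigroup with exactly three atoms $p_1,p_2,p_3\in\mathbb Z_m$, and let $z\ne z'$ be outer Betti elements of $N$ with $\mathrm{supp}(z)=\mathrm{supp}(z')=\{1,2\}$. Then $z$ or $z'$ is redundant.
   Context: Kunz cone $\mathcal C_m\subseteq\mathbb R^{m-1}$ (coordinates indexed by nonzero residues of $\mathbb Z_m$, $x_0=0$): defined by $x_i+x_j\ge x_{i+j}$ for nonzero $i,j$ with $i+j\ne0$. A face with trivial Kunz subgroup (no $x_i$, $i\ne0$, vanishing identically on it) has Kunz nilsemigroup $\mathbb Z_m\cup\{\infty\}$ with nil element $\infty$ and $a\oplus b=a+b$ if $x_a+x_b=x_{a+b}$ on the whole face, $\infty$ otherwise; a Kunz nilsemigroup means one arising this way. Atoms: nonzero elements not a sum of two nonzero ones. $\mathsf Z_N(n)=\{z\in\mathbb Z^3_{\ge0}: z_1p_1\oplus z_2p_2\oplus z_3p_3=n\}$, $\bar z=z_1p_1+z_2p_2+z_3p_3$ in $\mathbb Z_m$, $\mathrm{supp}(z)=\{i:z_i>0\}$. $N$ is staircase if every non-nil element has exactly one factorization; then an outer Betti element is a vector $b\in\mathsf Z_N(\infty)$ such that for each $i\in\mathrm{supp}(b)$, $b-e_i$ is a factorization of a non-nil element. Its Betti inequality is $b\cdot x\ge a\cdot x$ where $\mathsf Z_N(\bar b)=\{a\}$. $F_N\subseteq\mathbb R^3$ is the cone of points satisfying all Betti inequalities. An outer Betti element is redundant if its Betti inequality does not define a facet of $F_N$. -}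

module Defs where

open import Data.Nat as ℕ using (ℕ; zero; suc; NonZero)
open import Data.Nat.DivMod using (_mod_)
open import Data.Fin using (Fin; toℕ)
open import Data.Integer as ℤ using (ℤ; +_; 0ℤ; _≤_)
open import Data.List using (List; []; _∷_; _++_; replicate)
open import Data.Product using (Σ; ∃; _×_; _,_)
open import Data.Sum using (_⊎_)
open import Relation.Binary.PropositionalEquality using (_≡_; _≢_)
open import Relation.Nullary using (¬_)

V3 : Set → Set
V3 A = A × A × A

_·_ : V3 ℕ → V3 ℤ → ℤ
(a₁ , a₂ , a₃) · (x₁ , x₂ , x₃) =
  ((+ a₁) ℤ.* x₁ ℤ.+ (+ a₂) ℤ.* x₂) ℤ.+ (+ a₃) ℤ.* x₃

_⊕³_ : V3 ℤ → V3 ℤ → V3 ℤ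
(a , b , c) ⊕³ (x , y , z) = (a ℤ.+ x , b ℤ.+ y , c ℤ.+ z)

_⊛_ : ℤ → V3 ℤ → V3 ℤ
k ⊛ (x , y , z) = (k ℤ.* x , k ℤ.* y , k ℤ.* z)

0³ : V3 ℤ
0³ = (0ℤ , 0ℤ , 0ℤ)

lincomb : (k : ℕ) → (Fin k → ℤ) → (Fin k → V3 ℤ) → V3 ℤ
lincomb zero    c v = 0³
lincomb (suc k) c v =
  (c Fin.zero ⊛ v Fin.zero) ⊕³ lincomb k (λ i → c (Fin.suc i)) (λ i → v (Fin.suc i))

-- linear independence of a family of k vectors (integer coefficients;
-- equivalent to rational/real coefficients for integer vectors)
LinIndep : (k : ℕ) → (Fin k → V3 ℤ) → Set
LinIndep k v = (c : Fin k → ℤ) → lincomb k c v ≡ 0³ → (i : Fin k) → c i ≡ 0ℤ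

HasRank : ℕ → (V3 ℤ → Set) → Set
HasRank k S = Σ (Fin k → V3 ℤ) λ v → ((i : Fin k) → S (v i)) × LinIndep k v

Dim : (V3 ℤ → Set) → ℕ → Set
Dim S d = HasRank d S × ¬ HasRank (suc d) S

module Kunz (m : ℕ) .{{nz : NonZero m}} where

  _⊞_ : Fin m → Fin m → Fin m
  i ⊞ j = (toℕ i ℕ.+ toℕ j) mod m

  𝟘 : Fin m
  𝟘 = 0 mod m

  -- points of ℝ^{m-1} as functions on ℤ_m with x₀ = 0 (integer points)
  Point : Set
  Point = Fin m → ℤ

  ValidPair : Fin m → Fin m → Set
  ValidPair i j = i ≢ 𝟘 × j ≢ 𝟘 × (i ⊞ j) ≢ 𝟘

  InKunzCone : Point → Set
  InKunzCone x =
    x 𝟘 ≡ 0ℤ × (∀ i j → ValidPair i j → x (i ⊞ j) ≤ x i ℤ.+ x j)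

  -- a face of the Kunz cone, determined by a set S of defining
  -- inequalities that are required to be tight
  FaceData : Set₁
  FaceData = Fin m → Fin m → Set

  InFace : FaceData → Point → Set
  InFace S x = InKunzCone x × (∀ i j → ValidPair i j → S i j → x i ℤ.+ x j ≡ x (i ⊞ j))

  TrivialSubgroup : FaceData → Set
  TrivialSubgroup S = ∀ i → i ≢ 𝟘 → Σ Point λ x → InFace S x × x i ≢ 0ℤ

  module Nil (S : FaceData) where

    -- a ⊕ b = a + b  (i.e. is not ∞)
    Adds : Fin m → Fin m → Set
    Adds a b = ∀ x → InFace S x → x a ℤ.+ x b ≡ x (a ⊞ b)

    -- left-to-right ⊕-sum acc ⊕ l₁ ⊕ l₂ ⊕ ... is non-nil (≠ ∞)
    Defined : Fin m → List (Fin m) → Set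
    Defined acc []      = acc ≡ acc
    Defined acc (a ∷ l) = Adds acc a × Defined (acc ⊞ a) l

    sumℤm : Fin m → List (Fin m) → Fin m
    sumℤm acc []      = acc
    sumℤm acc (a ∷ l) = sumℤm (acc ⊞ a) l

    Atom : Fin m → Set
    Atom a = a ≢ 𝟘 × ¬ (Σ (Fin m) λ b → Σ (Fin m) λ c →
                          b ≢ 𝟘 × c ≢ 𝟘 × Adds b c × (b ⊞ c) ≡ a)

    module Atoms (p₁ p₂ p₃ : Fin m) where

      word : V3 ℕ → List (Fin m)
      word (z₁ , z₂ , z₃) = replicate z₁ p₁ ++ replicate z₂ p₂ ++ replicate z₃ p₃

      Fact : V3 ℕ → Fin m → Set
      Fact z n = Defined 𝟘 (word z) × sumℤm 𝟘 (word z) ≡ n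

      FactNil : V3 ℕ → Set
      FactNil z = ¬ Defined 𝟘 (word z)

      bar : V3 ℕ → Fin m
      bar z = sumℤm 𝟘 (word z)

      Staircase : Set
      Staircase = ∀ n → Σ (V3 ℕ) λ z → Fact z n × (∀ z' → Fact z' n → z' ≡ z)

      OuterBetti : V3 ℕ → Set
      OuterBetti (b₁ , b₂ , b₃) =
        FactNil (b₁ , b₂ , b₃)
        × (∀ k → b₁ ≡ suc k → Defined 𝟘 (word (k , b₂ , b₃)))
        × (∀ k → b₂ ≡ suc k → Defined 𝟘 (word (b₁ , k , b₃)))
        × (∀ k → b₃ ≡ suc k → Defined 𝟘 (word (b₁ , b₂ , k)))

      InFN : V3 ℤ → Set
      InFN x = ∀ b a → OuterBetti b → Fact a (bar b) → a · x ≤ b · x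

      DefinesFacet : V3 ℕ → V3 ℕ → Set
      DefinesFacet b a = Σ ℕ λ d →
        Dim InFN (suc d) × Dim (λ x → InFN x × b · x ≡ a · x) d

      Redundant : V3 ℕ → Set
      Redundant b = ∀ a → Fact a (bar b) → ¬ DefinesFacet b a

      Supp12 : V3 ℕ → Set
      Supp12 (z₁ , z₂ , z₃) = z₁ ≢ 0 × z₂ ≢ 0 × z₃ ≡ 0

-- Write z = (a, b, 0) and z′ = (a′, b′, 0). Outer Betti elements form an antichain, so after
-- swapping a < a′ and b′ < b. The factorisation of z̄ avoids the support of z (otherwise z − eᵢ
-- and that factorisation minus eᵢ would be equal factorisations of one element, making z
-- non-nil), so z̄ and z̄′ factor as (0, 0, k) and (0, 0, k′). Say k ≤ k′. Then
-- (z + (0, 0, k′)) + Q = (z′ + (0, 0, k)) + P, where Q = (a′ − a, 0, 0) lies below z′ − e₁ and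
-- is therefore a factorisation. Every inequality nf(y)·x ≤ y·x holds on F_N, in particular
-- Q·x ≤ P·x, so on the face of F_N where the Betti inequality of z is tight so is that of z′.
-- That face lies in two independent planes and has rank ≤ 1, whereas F_N has rank 3, so it is
-- no facet. Both facts about F_N come from a point x₀ of the face of the Kunz cone at which
-- every Betti inequality is strict: N·π(x₀) + eᵢ ∈ F_N for N large, and nf(y)·x ≤ y·x follows
-- by induction on y·π(x₀), replacing an outer Betti element b ≤ y by nf(b).

module Submission where

open import Defs
open import Data.Empty using (⊥; ⊥-elim)
open import Data.Fin as Fin using (Fin; toℕ)
import Data.Fin.Properties as Fin
open import Data.Integer as ℤ using (ℤ; +_; 0ℤ; 1ℤ; _+_; _*_; _-_; -_; _≤_; _<_)
import Data.Integer.Properties as ℤ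
open import Data.Integer.Tactic.RingSolver using (solve-∀)
open import Data.List using (List; []; _∷_; _++_; replicate; map; concatMap; allFin)
open import Data.List.Membership.Propositional using (_∈_)
open import Data.List.Membership.Propositional.Properties using (∈-concatMap⁺; ∈-map⁺; ∈-allFin)
open import Data.List.Properties using (map-++)
open import Data.List.Relation.Unary.All as All using (All; []; _∷_)
open import Data.List.Relation.Unary.Any as Any using (here; there)
open import Data.Nat as ℕ using (ℕ; zero; suc; NonZero; z≤n; s≤s)
open import Data.Nat.DivMod using (_mod_; _%_; %-distribˡ-+; [m+n]%n≡m%n; m*n%n≡0; m<n⇒m%n≡m)
open import Data.Nat.Induction using (<-wellFounded)
open import Data.Nat.ListAction using (sum)
open import Data.Nat.ListAction.Properties using (sum-++)
import Data.Nat.Properties as ℕ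
import Data.Nat.Tactic.RingSolver as ℕ-Solver
open import Data.Product using (∃; _×_; _,_; proj₁; proj₂)
open import Data.Sum as Sum using (_⊎_; inj₁; inj₂; [_,_]′)
open import Data.Vec.Functional using (zipWith)
open import Effect.Monad using (RawMonad)
open import Function using (_∘_; id)
import Induction.WellFounded as WF
open import Level using (0ℓ)
open import Relation.Binary.Definitions using (tri<; tri≈; tri>)
import Relation.Binary.Construct.On as On
open import Relation.Binary.PropositionalEquality
  using (_≡_; _≢_; refl; sym; trans; cong; cong₂; subst; subst₂; ≢-sym; module ≡-Reasoning)
open import Relation.Nullary using (¬_; yes; no)
open import Relation.Nullary.Decidable using (decidable-stable; ¬¬-excluded-middle)
open import Relation.Nullary.Negation using (¬¬-Monad; ¬¬-map)

open RawMonad (¬¬-Monad {a = 0ℓ}) using (pure; _>>=_)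

+-cancelʳ-≤ : ∀ {a b} c → a + c ≤ b + c → a ≤ b
+-cancelʳ-≤ {a} {b} c a+c≤b+c = begin
  a            ≡⟨ add-sub a c ⟨
  a + c + - c  ≤⟨ ℤ.+-monoˡ-≤ (- c) a+c≤b+c ⟩
  b + c + - c  ≡⟨ add-sub b c ⟩
  b            ∎
  where
  open ℤ.≤-Reasoning
  add-sub : ∀ x y → x + y + - y ≡ x
  add-sub = solve-∀

i≤i+j⇒0≤j : ∀ {i j} → i ≤ i + j → 0ℤ ≤ j
i≤i+j⇒0≤j {i} {j} i≤i+j = +-cancelʳ-≤ i (subst₂ _≤_ (sym (ℤ.+-identityˡ i)) (ℤ.+-comm i j) i≤i+j)

+-tightˡ : ∀ {a b c d} → a ≤ b → c ≤ d → b + d ≤ a + c → a ≡ b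
+-tightˡ {a} {b} {c} {d} a≤b c≤d b+d≤a+c = ℤ.≤-antisym a≤b (+-cancelʳ-≤ c b+c≤a+c)
  where
  d≤c : d ≤ c
  d≤c = +-cancelʳ-≤ b (subst₂ _≤_ (ℤ.+-comm b d) (ℤ.+-comm b c)
          (ℤ.≤-trans b+d≤a+c (ℤ.+-monoˡ-≤ c a≤b)))
  b+c≤a+c : b + c ≤ a + c
  b+c≤a+c = subst (λ t → b + t ≤ a + c) (ℤ.≤-antisym d≤c c≤d) b+d≤a+c

0≤n*i⇒0≤i : ∀ n .{{_ : NonZero n}} {i} → 0ℤ ≤ + n * i → 0ℤ ≤ i
0≤n*i⇒0≤i (suc n) {+ _}      _  = ℤ.+≤+ z≤n
0≤n*i⇒0≤i (suc n) {ℤ.-[1+ _ ]} ()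

0≤n*i : ∀ n {i} → 0ℤ ≤ i → 0ℤ ≤ + n * i
0≤n*i n {i} 0≤i = subst (_≤ + n * i) (ℤ.*-zeroʳ (+ n)) (ℤ.*-monoˡ-≤-nonNeg (+ n) 0≤i)

+-cancel-common : ∀ {a b c d e} → a + b + c ≡ d + a + e → b + c ≡ d + e
+-cancel-common {a} {b} {c} {d} {e} a+b+c≡d+a+e = begin
  b + c            ≡⟨ left a b c ⟨
  a + b + c + - a  ≡⟨ cong (_+ - a) a+b+c≡d+a+e ⟩
  d + a + e + - a  ≡⟨ right a d e ⟩
  d + e            ∎
  where
  open ≡-Reasoning
  left : ∀ a b c → a + b + c + - a ≡ b + c
  left = solve-∀
  right : ∀ a d e → d + a + e + - a ≡ d + e
  right = solve-∀

*-cancel-≢0 : ∀ {d x} → d ≢ 0ℤ → d * x ≡ 0ℤ → x ≡ 0ℤ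
*-cancel-≢0 {d} d≢0 dx≡0 with ℤ.i*j≡0⇒i≡0∨j≡0 d dx≡0
... | inj₁ d≡0 = ⊥-elim (d≢0 d≡0)
... | inj₂ x≡0 = x≡0

scaled-gap : ∀ {n a b i j} → 0ℤ ≤ n → a < b → i ≤ n → 0ℤ ≤ j → n * a + i ≤ n * b + j
scaled-gap {n} {a} {b} {i} {j} 0≤n a<b i≤n 0≤j = begin
  n * a + i     ≤⟨ ℤ.+-monoʳ-≤ (n * a) i≤n ⟩
  n * a + n     ≡⟨ lemma n a ⟩
  n * (1ℤ + a)  ≤⟨ ℤ.*-monoˡ-≤-nonNeg n {{ℤ.nonNegative 0≤n}} (ℤ.i<j⇒suc[i]≤j a<b) ⟩
  n * b         ≤⟨ ℤ.i≤i+j (n * b) j {{ℤ.nonNegative 0≤j}} ⟩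
  n * b + j     ∎
  where
  open ℤ.≤-Reasoning
  lemma : ∀ n a → n * a + n ≡ n * (1ℤ + a)
  lemma = solve-∀

¬¬-least : (D : ℕ → Set) → ∀ n → ¬ D n → ¬ ¬ (∃ λ k → k ℕ.≤ n × ¬ D k × (∀ j → k ≡ suc j → D j))
¬¬-least D zero    ¬D₀ = pure (0 , z≤n , ¬D₀ , λ _ ())
¬¬-least D (suc n) ¬D  = ¬¬-excluded-middle >>= λ where
  (yes Dn) → pure (suc n , ℕ.≤-refl , ¬D , λ { _ refl → Dn })
  (no ¬Dn) → ¬¬-map (λ (k , k≤n , ¬Dk , below) → k , ℕ.m≤n⇒m≤1+n k≤n , ¬Dk , below) (¬¬-least D n ¬Dn)

m+[n∸m]≡n+[m∸n] : ∀ m n → m ℕ.+ (n ℕ.∸ m) ≡ n ℕ.+ (m ℕ.∸ n)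
m+[n∸m]≡n+[m∸n] zero    zero    = refl
m+[n∸m]≡n+[m∸n] zero    (suc n) = cong suc (sym (ℕ.+-identityʳ n))
m+[n∸m]≡n+[m∸n] (suc m) zero    = cong suc (ℕ.+-identityʳ m)
m+[n∸m]≡n+[m∸n] (suc m) (suc n) = cong suc (m+[n∸m]≡n+[m∸n] m n)

Fin-bounded : ∀ {n} (f : Fin n → ℕ) → ∃ λ N → ∀ i → f i ℕ.≤ N
Fin-bounded {zero}  f = 0 , λ ()
Fin-bounded {suc n} f = f Fin.zero ℕ.⊔ N , bound′
  where
  N = proj₁ (Fin-bounded (f ∘ Fin.suc))
  bound′ : ∀ i → f i ℕ.≤ f Fin.zero ℕ.⊔ N
  bound′ Fin.zero    = ℕ.m≤m⊔n (f Fin.zero) N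
  bound′ (Fin.suc i) = ℕ.≤-trans (proj₂ (Fin-bounded (f ∘ Fin.suc)) i) (ℕ.m≤n⊔m (f Fin.zero) N)

_+³_ : V3 ℕ → V3 ℕ → V3 ℕ
(a₁ , a₂ , a₃) +³ (b₁ , b₂ , b₃) = (a₁ ℕ.+ b₁ , a₂ ℕ.+ b₂ , a₃ ℕ.+ b₃)

+³-comm : ∀ v w → v +³ w ≡ w +³ v
+³-comm (a₁ , a₂ , a₃) (b₁ , b₂ , b₃) =
  cong₂ _,_ (ℕ.+-comm a₁ b₁) (cong₂ _,_ (ℕ.+-comm a₂ b₂) (ℕ.+-comm a₃ b₃))

_∸³_ : V3 ℕ → V3 ℕ → V3 ℕ
(a₁ , a₂ , a₃) ∸³ (b₁ , b₂ , b₃) = (a₁ ℕ.∸ b₁ , a₂ ℕ.∸ b₂ , a₃ ℕ.∸ b₃)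

+³-∸³-comm : ∀ v w → v +³ (w ∸³ v) ≡ w +³ (v ∸³ w)
+³-∸³-comm (a₁ , a₂ , a₃) (b₁ , b₂ , b₃) =
  cong₂ _,_ (m+[n∸m]≡n+[m∸n] a₁ b₁) (cong₂ _,_ (m+[n∸m]≡n+[m∸n] a₂ b₂) (m+[n∸m]≡n+[m∸n] a₃ b₃))

_≤³_ : V3 ℕ → V3 ℕ → Set
(a₁ , a₂ , a₃) ≤³ (b₁ , b₂ , b₃) = a₁ ℕ.≤ b₁ × a₂ ℕ.≤ b₂ × a₃ ℕ.≤ b₃

≤³⇒∃+³ : ∀ {v w} → v ≤³ w → ∃ λ r → v +³ r ≡ w
≤³⇒∃+³ {a₁ , a₂ , a₃} {b₁ , b₂ , b₃} (a₁≤b₁ , a₂≤b₂ , a₃≤b₃) =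
  (b₁ ℕ.∸ a₁ , b₂ ℕ.∸ a₂ , b₃ ℕ.∸ a₃) ,
  cong₂ _,_ (ℕ.m+[n∸m]≡n a₁≤b₁) (cong₂ _,_ (ℕ.m+[n∸m]≡n a₂≤b₂) (ℕ.m+[n∸m]≡n a₃≤b₃))

size : V3 ℕ → ℕ
size (a₁ , a₂ , a₃) = a₁ ℕ.+ a₂ ℕ.+ a₃

coord : Fin 3 → V3 ℕ → ℕ
coord Fin.zero             (a₁ , _ , _) = a₁
coord (Fin.suc Fin.zero)   (_ , a₂ , _) = a₂
coord (Fin.suc (Fin.suc _)) (_ , _ , a₃) = a₃

coord≤size : ∀ i a → coord i a ℕ.≤ size a
coord≤size Fin.zero             (a₁ , a₂ , a₃) = ℕ.≤-trans (ℕ.m≤m+n a₁ a₂) (ℕ.m≤m+n (a₁ ℕ.+ a₂) a₃)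
coord≤size (Fin.suc Fin.zero)   (a₁ , a₂ , a₃) = ℕ.≤-trans (ℕ.m≤n+m a₂ a₁) (ℕ.m≤m+n (a₁ ℕ.+ a₂) a₃)
coord≤size (Fin.suc (Fin.suc _)) (a₁ , a₂ , a₃) = ℕ.m≤n+m a₃ (a₁ ℕ.+ a₂)

ε : Fin 3 → V3 ℤ
ε Fin.zero              = (1ℤ , 0ℤ , 0ℤ)
ε (Fin.suc Fin.zero)    = (0ℤ , 1ℤ , 0ℤ)
ε (Fin.suc (Fin.suc _)) = (0ℤ , 0ℤ , 1ℤ)

·-distribʳ-+³ : ∀ v w y → (v +³ w) · y ≡ v · y + w · y
·-distribʳ-+³ (a₁ , a₂ , a₃) (b₁ , b₂ , b₃) (y₁ , y₂ , y₃)
  rewrite ℤ.pos-+ a₁ b₁ | ℤ.pos-+ a₂ b₂ | ℤ.pos-+ a₃ b₃ =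
    lemma (+ a₁) (+ a₂) (+ a₃) (+ b₁) (+ b₂) (+ b₃) y₁ y₂ y₃
  where
  lemma : ∀ a₁ a₂ a₃ b₁ b₂ b₃ y₁ y₂ y₃ →
    (a₁ + b₁) * y₁ + (a₂ + b₂) * y₂ + (a₃ + b₃) * y₃ ≡
    (a₁ * y₁ + a₂ * y₂ + a₃ * y₃) + (b₁ * y₁ + b₂ * y₂ + b₃ * y₃)
  lemma = solve-∀

·-distribˡ-⊕³ : ∀ a u v → a · (u ⊕³ v) ≡ a · u + a · v
·-distribˡ-⊕³ (a₁ , a₂ , a₃) (u₁ , u₂ , u₃) (v₁ , v₂ , v₃) = lemma (+ a₁) (+ a₂) (+ a₃) u₁ u₂ u₃ v₁ v₂ v₃
  where
  lemma : ∀ a₁ a₂ a₃ u₁ u₂ u₃ v₁ v₂ v₃ →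
    a₁ * (u₁ + v₁) + a₂ * (u₂ + v₂) + a₃ * (u₃ + v₃) ≡
    (a₁ * u₁ + a₂ * u₂ + a₃ * u₃) + (a₁ * v₁ + a₂ * v₂ + a₃ * v₃)
  lemma = solve-∀

·-⊛ : ∀ a k y → a · (k ⊛ y) ≡ k * (a · y)
·-⊛ (a₁ , a₂ , a₃) k (y₁ , y₂ , y₃) = lemma (+ a₁) (+ a₂) (+ a₃) k y₁ y₂ y₃
  where
  lemma : ∀ a₁ a₂ a₃ k y₁ y₂ y₃ →
    a₁ * (k * y₁) + a₂ * (k * y₂) + a₃ * (k * y₃) ≡ k * (a₁ * y₁ + a₂ * y₂ + a₃ * y₃)
  lemma = solve-∀

·-nonNeg : ∀ a {y₁ y₂ y₃} → 0ℤ ≤ y₁ → 0ℤ ≤ y₂ → 0ℤ ≤ y₃ → 0ℤ ≤ a · (y₁ , y₂ , y₃)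
·-nonNeg (a₁ , a₂ , a₃) 0≤y₁ 0≤y₂ 0≤y₃ = ℤ.+-mono-≤ (ℤ.+-mono-≤ (0≤n*i a₁ 0≤y₁) (0≤n*i a₂ 0≤y₂)) (0≤n*i a₃ 0≤y₃)

·-ε : ∀ i a → a · ε i ≡ + coord i a
·-ε Fin.zero              (a₁ , a₂ , a₃) = lemma (+ a₁) (+ a₂) (+ a₃)
  where
  lemma : ∀ a₁ a₂ a₃ → a₁ * 1ℤ + a₂ * 0ℤ + a₃ * 0ℤ ≡ a₁
  lemma = solve-∀
·-ε (Fin.suc Fin.zero)    (a₁ , a₂ , a₃) = lemma (+ a₁) (+ a₂) (+ a₃)
  where
  lemma : ∀ a₁ a₂ a₃ → a₁ * 0ℤ + a₂ * 1ℤ + a₃ * 0ℤ ≡ a₂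
  lemma = solve-∀
·-ε (Fin.suc (Fin.suc _)) (a₁ , a₂ , a₃) = lemma (+ a₁) (+ a₂) (+ a₃)
  where
  lemma : ∀ a₁ a₂ a₃ → a₁ * 0ℤ + a₂ * 0ℤ + a₃ * 1ℤ ≡ a₃
  lemma = solve-∀

_∙_ : V3 ℤ → V3 ℤ → ℤ
(u₁ , u₂ , u₃) ∙ (v₁ , v₂ , v₃) = u₁ * v₁ + u₂ * v₂ + u₃ * v₃

_-³_ : V3 ℕ → V3 ℕ → V3 ℤ
(a₁ , a₂ , a₃) -³ (b₁ , b₂ , b₃) = (+ a₁ - + b₁ , + a₂ - + b₂ , + a₃ - + b₃)

∙-diff : ∀ a b y → (a -³ b) ∙ y ≡ a · y - b · y
∙-diff (a₁ , a₂ , a₃) (b₁ , b₂ , b₃) (y₁ , y₂ , y₃) = lemma (+ a₁) (+ a₂) (+ a₃) (+ b₁) (+ b₂) (+ b₃) y₁ y₂ y₃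
  where
  lemma : ∀ a₁ a₂ a₃ b₁ b₂ b₃ y₁ y₂ y₃ →
    (a₁ - b₁) * y₁ + (a₂ - b₂) * y₂ + (a₃ - b₃) * y₃ ≡
    (a₁ * y₁ + a₂ * y₂ + a₃ * y₃) - (b₁ * y₁ + b₂ * y₂ + b₃ * y₃)
  lemma = solve-∀

∙-diff≡0 : ∀ {a b y} → a · y ≡ b · y → (a -³ b) ∙ y ≡ 0ℤ
∙-diff≡0 {a} {b} {y} a·y≡b·y = trans (∙-diff a b y) (trans (cong (_- b · y) a·y≡b·y) (ℤ.+-inverseʳ (b · y)))

third : V3 ℤ → ℤ
third = proj₂ ∘ proj₂

pair : {A : Set} → A → A → Fin 2 → A
pair a _ Fin.zero    = a
pair _ b (Fin.suc _) = b

HasRank-pred : ∀ {k} {P : V3 ℤ → Set} → HasRank (suc k) P → HasRank k P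
HasRank-pred {k} (v , v∈P , indep) = v ∘ Fin.suc , v∈P ∘ Fin.suc , indep-tail
  where
  indep-tail : LinIndep k (v ∘ Fin.suc)
  indep-tail c comb≡0 i = indep c′ comb′≡0 (Fin.suc i)
    where
    c′ : Fin (suc k) → ℤ
    c′ Fin.zero    = 0ℤ
    c′ (Fin.suc j) = c j
    comb′≡0 : lincomb (suc k) c′ v ≡ 0³
    comb′≡0 = trans (cong₂ _,_ (ℤ.+-identityˡ _) (cong₂ _,_ (ℤ.+-identityˡ _) (ℤ.+-identityˡ _))) comb≡0

HasRank-≤ : ∀ {k n} {P : V3 ℤ → Set} → k ℕ.≤ n → HasRank n P → HasRank k P
HasRank-≤ {P = P} = go ∘ ℕ.≤⇒≤′
  where
  go : ∀ {k n} → k ℕ.≤′ n → HasRank n P → HasRank k P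
  go ℕ.≤′-refl     = id
  go (ℕ.≤′-step p) = go p ∘ HasRank-pred {P = P}

HasRank-⊆ : ∀ {k} {P Q : V3 ℤ → Set} → (∀ {v} → P v → Q v) → HasRank k P → HasRank k Q
HasRank-⊆ P⊆Q (v , v∈P , indep) = v , P⊆Q ∘ v∈P , indep

facet-rank : ∀ {d} {P Q : V3 ℤ → Set} → HasRank 3 P → Dim P (suc d) → Dim Q d → HasRank 2 Q
facet-rank {zero}        {P}     r₃ (_ , ¬r₂) _       = ⊥-elim (¬r₂ (HasRank-pred {P = P} r₃))
facet-rank {suc zero}                r₃ (_ , ¬r₃) _       = ⊥-elim (¬r₃ r₃)
facet-rank {suc (suc d)} {Q = Q} _  _         (r , _) = HasRank-≤ {P = Q} (s≤s (s≤s z≤n)) r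

det₁₂ : V3 ℤ → V3 ℤ → ℤ
det₁₂ (u₁ , u₂ , _) (w₁ , w₂ , _) = u₁ * w₂ - u₂ * w₁

Kernel : V3 ℤ → V3 ℤ → V3 ℤ → Set
Kernel u w v = u ∙ v ≡ 0ℤ × w ∙ v ≡ 0ℤ

kernel-third≡0⇒≡0³ : ∀ {u w v} → det₁₂ u w ≢ 0ℤ → Kernel u w v → third v ≡ 0ℤ → v ≡ 0³
kernel-third≡0⇒≡0³ {u₁ , u₂ , u₃} {w₁ , w₂ , w₃} {v₁ , v₂ , _} D≢0 (u∙v≡0 , w∙v≡0) refl =
  cong₂ _,_ (*-cancel-≢0 D≢0 (trans (cramer₁ u₁ u₂ u₃ w₁ w₂ w₃ v₁ v₂) (vanish w₂ u₂)))
            (cong₂ _,_ (*-cancel-≢0 D≢0 (trans (cramer₂ u₁ u₂ u₃ w₁ w₂ w₃ v₁ v₂) (vanish (- w₁) (- u₁)))) refl)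
  where
  cramer₁ : ∀ u₁ u₂ u₃ w₁ w₂ w₃ v₁ v₂ → (u₁ * w₂ - u₂ * w₁) * v₁ ≡
    w₂ * (u₁ * v₁ + u₂ * v₂ + u₃ * 0ℤ) - u₂ * (w₁ * v₁ + w₂ * v₂ + w₃ * 0ℤ)
  cramer₁ = solve-∀
  cramer₂ : ∀ u₁ u₂ u₃ w₁ w₂ w₃ v₁ v₂ → (u₁ * w₂ - u₂ * w₁) * v₂ ≡
    (- w₁) * (u₁ * v₁ + u₂ * v₂ + u₃ * 0ℤ) - (- u₁) * (w₁ * v₁ + w₂ * v₂ + w₃ * 0ℤ)
  cramer₂ = solve-∀
  vanish : ∀ a b → a * (u₁ * v₁ + u₂ * v₂ + u₃ * 0ℤ) - b * (w₁ * v₁ + w₂ * v₂ + w₃ * 0ℤ) ≡ 0ℤ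
  vanish a b rewrite u∙v≡0 | w∙v≡0 = lemma a b
    where
    lemma : ∀ a b → a * 0ℤ - b * 0ℤ ≡ 0ℤ
    lemma = solve-∀

∙-lincomb₂ : ∀ u c₀ c₁ v v′ → u ∙ lincomb 2 (pair c₀ c₁) (pair v v′) ≡ c₀ * (u ∙ v) + c₁ * (u ∙ v′)
∙-lincomb₂ (u₁ , u₂ , u₃) c₀ c₁ (v₁ , v₂ , v₃) (v₁′ , v₂′ , v₃′) =
  lemma u₁ u₂ u₃ c₀ c₁ v₁ v₂ v₃ v₁′ v₂′ v₃′
  where
  lemma : ∀ u₁ u₂ u₃ c₀ c₁ v₁ v₂ v₃ v₁′ v₂′ v₃′ →
    u₁ * (c₀ * v₁ + (c₁ * v₁′ + 0ℤ)) + u₂ * (c₀ * v₂ + (c₁ * v₂′ + 0ℤ)) + u₃ * (c₀ * v₃ + (c₁ * v₃′ + 0ℤ)) ≡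
    c₀ * (u₁ * v₁ + u₂ * v₂ + u₃ * v₃) + c₁ * (u₁ * v₁′ + u₂ * v₂′ + u₃ * v₃′)
  lemma = solve-∀

¬HasRank2-kernel : ∀ {u w} → det₁₂ u w ≢ 0ℤ → ¬ HasRank 2 (Kernel u w)
¬HasRank2-kernel {u} {w} D≢0 (v , v∈K , indep) = 1≢0 (indep (pair 1ℤ 0ℤ) v₀-comb≡0 Fin.zero)
  where
  x = v Fin.zero
  y = v (Fin.suc Fin.zero)
  -- y₃ x − x₃ y lies in the kernel and has third coordinate 0, so it vanishes
  c = pair (third y) (- third x)
  comb-∈K : Kernel u w (lincomb 2 c v)
  comb-∈K = vanish u (proj₁ (v∈K Fin.zero)) (proj₁ (v∈K (Fin.suc Fin.zero))) ,
            vanish w (proj₂ (v∈K Fin.zero)) (proj₂ (v∈K (Fin.suc Fin.zero)))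
    where
    vanish : ∀ t → t ∙ x ≡ 0ℤ → t ∙ y ≡ 0ℤ → t ∙ lincomb 2 c v ≡ 0ℤ
    vanish t t∙x≡0 t∙y≡0 = trans (∙-lincomb₂ t (third y) (- third x) x y)
      (trans (cong₂ (λ p q → third y * p + (- third x) * q) t∙x≡0 t∙y≡0) (lemma (third y) (- third x)))
      where
      lemma : ∀ a b → a * 0ℤ + b * 0ℤ ≡ 0ℤ
      lemma = solve-∀
  comb-third≡0 : third (lincomb 2 c v) ≡ 0ℤ
  comb-third≡0 = lemma (third x) (third y)
    where
    lemma : ∀ a b → b * a + (- a * b + 0ℤ) ≡ 0ℤ
    lemma = solve-∀
  x₃≡0 : third x ≡ 0ℤ
  x₃≡0 = ℤ.neg-injective (indep c (kernel-third≡0⇒≡0³ {u} {w} D≢0 comb-∈K comb-third≡0) (Fin.suc Fin.zero))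
  x≡0 : x ≡ 0³
  x≡0 = kernel-third≡0⇒≡0³ {u} {w} D≢0 (v∈K Fin.zero) x₃≡0
  v₀-comb≡0 : lincomb 2 (pair 1ℤ 0ℤ) v ≡ 0³
  v₀-comb≡0 = subst (λ t → (1ℤ ⊛ t) ⊕³ ((0ℤ ⊛ y) ⊕³ 0³) ≡ 0³) (sym x≡0) refl
  1≢0 : 1ℤ ≢ 0ℤ
  1≢0 ()

LinIndep-shifted-basis : ∀ {y₁ y₂ y₃} → 0ℤ ≤ y₁ → 0ℤ ≤ y₂ → 0ℤ ≤ y₃ →
                         LinIndep 3 (λ i → (y₁ , y₂ , y₃) ⊕³ ε i)
LinIndep-shifted-basis {y₁} {y₂} {y₃} 0≤y₁ 0≤y₂ 0≤y₃ c comb≡0 = c≡0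
  where
  c₁ = c Fin.zero
  c₂ = c (Fin.suc Fin.zero)
  c₃ = c (Fin.suc (Fin.suc Fin.zero))
  s  = c₁ + c₂ + c₃
  coord₁ : c₁ + s * y₁ ≡ 0ℤ
  coord₁ = trans (lemma c₁ c₂ c₃ y₁) (cong proj₁ comb≡0)
    where
    lemma : ∀ c₁ c₂ c₃ y → c₁ + (c₁ + c₂ + c₃) * y ≡ c₁ * (y + 1ℤ) + (c₂ * (y + 0ℤ) + (c₃ * (y + 0ℤ) + 0ℤ))
    lemma = solve-∀
  coord₂ : c₂ + s * y₂ ≡ 0ℤ
  coord₂ = trans (lemma c₁ c₂ c₃ y₂) (cong (proj₁ ∘ proj₂) comb≡0)
    where
    lemma : ∀ c₁ c₂ c₃ y → c₂ + (c₁ + c₂ + c₃) * y ≡ c₁ * (y + 0ℤ) + (c₂ * (y + 1ℤ) + (c₃ * (y + 0ℤ) + 0ℤ))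
    lemma = solve-∀
  coord₃ : c₃ + s * y₃ ≡ 0ℤ
  coord₃ = trans (lemma c₁ c₂ c₃ y₃) (cong (proj₂ ∘ proj₂) comb≡0)
    where
    lemma : ∀ c₁ c₂ c₃ y → c₃ + (c₁ + c₂ + c₃) * y ≡ c₁ * (y + 0ℤ) + (c₂ * (y + 0ℤ) + (c₃ * (y + 1ℤ) + 0ℤ))
    lemma = solve-∀
  s≡0 : s ≡ 0ℤ
  s≡0 = *-cancel-≢0 1+y≢0 (trans (lemma c₁ c₂ c₃ y₁ y₂ y₃) (cong₂ _+_ (cong₂ _+_ coord₁ coord₂) coord₃))
    where
    lemma : ∀ c₁ c₂ c₃ y₁ y₂ y₃ → (1ℤ + (y₁ + y₂ + y₃)) * (c₁ + c₂ + c₃) ≡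
      (c₁ + (c₁ + c₂ + c₃) * y₁) + (c₂ + (c₁ + c₂ + c₃) * y₂) + (c₃ + (c₁ + c₂ + c₃) * y₃)
    lemma = solve-∀
    1+y≢0 : 1ℤ + (y₁ + y₂ + y₃) ≢ 0ℤ
    1+y≢0 = ≢-sym (ℤ.<⇒≢ (ℤ.suc[i]≤j⇒i<j
      (ℤ.+-monoʳ-≤ 1ℤ (ℤ.+-mono-≤ (ℤ.+-mono-≤ 0≤y₁ 0≤y₂) 0≤y₃))))
  vanishes : ∀ {a y} → a + s * y ≡ 0ℤ → a ≡ 0ℤ
  vanishes {a} {y} a+sy≡0 = trans (sym (ℤ.+-identityʳ a)) (trans (cong (λ t → a + t * y) (sym s≡0)) a+sy≡0)
  c≡0 : ∀ i → c i ≡ 0ℤ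
  c≡0 Fin.zero                = vanishes coord₁
  c≡0 (Fin.suc Fin.zero)      = vanishes coord₂
  c≡0 (Fin.suc (Fin.suc Fin.zero)) = vanishes coord₃

det₁₂-supp₁₂ : ∀ a b a′ b′ k k′ → a ℕ.* b′ ≢ b ℕ.* a′ →
               det₁₂ ((a , b , 0) -³ (0 , 0 , k)) ((a′ , b′ , 0) -³ (0 , 0 , k′)) ≢ 0ℤ
det₁₂-supp₁₂ a b a′ b′ k k′ ab′≢ba′ det≡0 = ab′≢ba′ (ℤ.+-injective (begin
  + (a ℕ.* b′)  ≡⟨ ℤ.pos-* a b′ ⟩
  + a * + b′    ≡⟨ ℤ.i-j≡0⇒i≡j _ _ (trans (sym (lemma (+ a) (+ b) (+ a′) (+ b′))) det≡0) ⟩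
  + b * + a′    ≡⟨ ℤ.pos-* b a′ ⟨
  + (b ℕ.* a′)  ∎))
  where
  open ≡-Reasoning
  lemma : ∀ a b a′ b′ → (a - 0ℤ) * (b′ - 0ℤ) - (b - 0ℤ) * (a′ - 0ℤ) ≡ a * b′ - b * a′
  lemma = solve-∀

module ZMod (m : ℕ) .{{_ : NonZero m}} where
  open Kunz m
  open ≡-Reasoning

  toℕ-mod : ∀ n → toℕ (n mod m) ≡ n % m
  toℕ-mod n = Fin.toℕ-fromℕ< _

  mod-toℕ : ∀ i → toℕ i mod m ≡ i
  mod-toℕ i = Fin.toℕ-injective (trans (toℕ-mod (toℕ i)) (m<n⇒m%n≡m (Fin.toℕ<n i)))

  mod-cong : ∀ {a b} → a % m ≡ b % m → a mod m ≡ b mod m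
  mod-cong {a} {b} a≡b = Fin.toℕ-injective (trans (toℕ-mod a) (trans a≡b (sym (toℕ-mod b))))

  mod-+ : ∀ a b → (a mod m) ⊞ (b mod m) ≡ (a ℕ.+ b) mod m
  mod-+ a b = mod-cong (begin
    (toℕ (a mod m) ℕ.+ toℕ (b mod m)) % m  ≡⟨ cong₂ (λ p q → (p ℕ.+ q) % m) (toℕ-mod a) (toℕ-mod b) ⟩
    (a % m ℕ.+ b % m) % m                  ≡⟨ %-distribˡ-+ a b m ⟨
    (a ℕ.+ b) % m                          ∎)

  mod-multiple : ∀ n → (m ℕ.* n) mod m ≡ 𝟘
  mod-multiple n = mod-cong (begin
    (m ℕ.* n) % m  ≡⟨ cong (_% m) (ℕ.*-comm m n) ⟩
    (n ℕ.* m) % m  ≡⟨ m*n%n≡0 n m ⟩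
    0              ≡⟨ m<n⇒m%n≡m (ℕ.>-nonZero⁻¹ m) ⟨
    0 % m          ∎)

  ⊞-comm : ∀ i j → i ⊞ j ≡ j ⊞ i
  ⊞-comm i j = cong (_mod m) (ℕ.+-comm (toℕ i) (toℕ j))

  ⊞-assoc : ∀ i j k → (i ⊞ j) ⊞ k ≡ i ⊞ (j ⊞ k)
  ⊞-assoc i j k = begin
    (i ⊞ j) ⊞ k                    ≡⟨ cong ((i ⊞ j) ⊞_) (mod-toℕ k) ⟨
    ((I ℕ.+ J) mod m) ⊞ (K mod m)  ≡⟨ mod-+ (I ℕ.+ J) K ⟩
    (I ℕ.+ J ℕ.+ K) mod m          ≡⟨ cong (_mod m) (ℕ.+-assoc I J K) ⟩
    (I ℕ.+ (J ℕ.+ K)) mod m        ≡⟨ mod-+ I (J ℕ.+ K) ⟨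
    (I mod m) ⊞ ((J ℕ.+ K) mod m)  ≡⟨ cong (_⊞ (j ⊞ k)) (mod-toℕ i) ⟩
    i ⊞ (j ⊞ k)                    ∎
    where
    I = toℕ i
    J = toℕ j
    K = toℕ k

  ⊞-identityˡ : ∀ i → 𝟘 ⊞ i ≡ i
  ⊞-identityˡ i = begin
    𝟘 ⊞ i              ≡⟨ cong (𝟘 ⊞_) (mod-toℕ i) ⟨
    𝟘 ⊞ (toℕ i mod m)  ≡⟨ mod-+ 0 (toℕ i) ⟩
    toℕ i mod m        ≡⟨ mod-toℕ i ⟩
    i                  ∎

  ⊞-identityʳ : ∀ i → i ⊞ 𝟘 ≡ i
  ⊞-identityʳ i = trans (⊞-comm i 𝟘) (⊞-identityˡ i)

  infix 25 ⊟_

  ⊟_ : Fin m → Fin m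
  ⊟ i = (m ℕ.∸ toℕ i) mod m

  ⊞-inverseˡ : ∀ i → ⊟ i ⊞ i ≡ 𝟘
  ⊞-inverseˡ i = begin
    ⊟ i ⊞ i                                ≡⟨ cong (⊟ i ⊞_) (mod-toℕ i) ⟨
    ((m ℕ.∸ toℕ i) mod m) ⊞ (toℕ i mod m)  ≡⟨ mod-+ (m ℕ.∸ toℕ i) (toℕ i) ⟩
    (m ℕ.∸ toℕ i ℕ.+ toℕ i) mod m          ≡⟨ cong (_mod m) (ℕ.m∸n+n≡m (ℕ.<⇒≤ (Fin.toℕ<n i))) ⟩
    m mod m                                ≡⟨ mod-cong ([m+n]%n≡m%n 0 m) ⟩
    𝟘                                      ∎

  ⊞-cancelˡ : ∀ i {j k} → i ⊞ j ≡ i ⊞ k → j ≡ k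
  ⊞-cancelˡ i {j} {k} i⊞j≡i⊞k = begin
    j              ≡⟨ ⊞-identityˡ j ⟨
    𝟘 ⊞ j          ≡⟨ cong (_⊞ j) (⊞-inverseˡ i) ⟨
    (⊟ i ⊞ i) ⊞ j  ≡⟨ ⊞-assoc (⊟ i) i j ⟩
    ⊟ i ⊞ (i ⊞ j)  ≡⟨ cong (⊟ i ⊞_) i⊞j≡i⊞k ⟩
    ⊟ i ⊞ (i ⊞ k)  ≡⟨ ⊞-assoc (⊟ i) i k ⟨
    (⊟ i ⊞ i) ⊞ k  ≡⟨ cong (_⊞ k) (⊞-inverseˡ i) ⟩
    𝟘 ⊞ k          ≡⟨ ⊞-identityˡ k ⟩
    k              ∎

module Nilsemigroup (m : ℕ) .{{_ : NonZero m}} (S : Kunz.FaceData m) where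
  open Kunz m
  open Nil S
  open ZMod m

  ∑ : Point → List (Fin m) → ℤ
  ∑ x []      = 0ℤ
  ∑ x (a ∷ l) = x a + ∑ x l

  ∑-++ : ∀ x l₁ l₂ → ∑ x (l₁ ++ l₂) ≡ ∑ x l₁ + ∑ x l₂
  ∑-++ x []       l₂ = sym (ℤ.+-identityˡ (∑ x l₂))
  ∑-++ x (a ∷ l₁) l₂ = trans (cong (_+_ (x a)) (∑-++ x l₁ l₂)) (sym (ℤ.+-assoc (x a) _ _))

  ∑-replicate : ∀ x n a → ∑ x (replicate n a) ≡ + n * x a
  ∑-replicate x zero    a = sym (ℤ.*-zeroˡ (x a))
  ∑-replicate x (suc n) a = trans (cong (_+_ (x a)) (∑-replicate x n a)) (sym (ℤ.suc-* (+ n) (x a)))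

  sum-toℕ-replicate : ∀ n (a : Fin m) → sum (map toℕ (replicate n a)) ≡ n ℕ.* toℕ a
  sum-toℕ-replicate zero    a = refl
  sum-toℕ-replicate (suc n) a = cong (toℕ a ℕ.+_) (sum-toℕ-replicate n a)

  sum-toℕ-++ : ∀ (l₁ l₂ : List (Fin m)) → sum (map toℕ (l₁ ++ l₂)) ≡ sum (map toℕ l₁) ℕ.+ sum (map toℕ l₂)
  sum-toℕ-++ l₁ l₂ = trans (cong sum (map-++ toℕ l₁ l₂)) (sum-++ (map toℕ l₁) (map toℕ l₂))

  sumℤm-mod : ∀ acc l → sumℤm acc l ≡ acc ⊞ (sum (map toℕ l) mod m)
  sumℤm-mod acc []      = sym (⊞-identityʳ acc)
  sumℤm-mod acc (a ∷ l) = begin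
    sumℤm (acc ⊞ a) l                   ≡⟨ sumℤm-mod (acc ⊞ a) l ⟩
    (acc ⊞ a) ⊞ (Σl mod m)              ≡⟨ ⊞-assoc acc a (Σl mod m) ⟩
    acc ⊞ (a ⊞ (Σl mod m))              ≡⟨ cong (λ t → acc ⊞ (t ⊞ (Σl mod m))) (mod-toℕ a) ⟨
    acc ⊞ ((toℕ a mod m) ⊞ (Σl mod m))  ≡⟨ cong (acc ⊞_) (mod-+ (toℕ a) Σl) ⟩
    acc ⊞ ((toℕ a ℕ.+ Σl) mod m)        ∎
    where
    open ≡-Reasoning
    Σl = sum (map toℕ l)

  face-0 : InFace S (λ _ → 0ℤ)
  face-0 = (refl , λ _ _ _ → ℤ.≤-refl) , λ _ _ _ _ → refl

  face-+ : ∀ x y → InFace S x → InFace S y → InFace S (zipWith _+_ x y)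
  face-+ x y ((x𝟘 , x-sub) , x-tight) ((y𝟘 , y-sub) , y-tight) =
    (cong₂ _+_ x𝟘 y𝟘 ,
     λ i j ij → ℤ.≤-trans (ℤ.+-mono-≤ (x-sub i j ij) (y-sub i j ij))
                          (ℤ.≤-reflexive (shuffle (x i) (x j) (y i) (y j)))) ,
    λ i j ij s → trans (shuffle (x i) (y i) (x j) (y j)) (cong₂ _+_ (x-tight i j ij s) (y-tight i j ij s))
    where
    shuffle : ∀ a b c d → (a + b) + (c + d) ≡ (a + c) + (b + d)
    shuffle = solve-∀

  Defined⇒tight : ∀ x → InFace S x → ∀ acc l → Defined acc l → x (sumℤm acc l) ≡ x acc + ∑ x l
  Defined⇒tight x x∈F acc []      _                = sym (ℤ.+-identityʳ (x acc))
  Defined⇒tight x x∈F acc (a ∷ l) (adds , defined) = begin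
    x (sumℤm (acc ⊞ a) l)  ≡⟨ Defined⇒tight x x∈F (acc ⊞ a) l defined ⟩
    x (acc ⊞ a) + ∑ x l    ≡⟨ cong (_+ ∑ x l) (adds x x∈F) ⟨
    x acc + x a + ∑ x l    ≡⟨ ℤ.+-assoc (x acc) (x a) (∑ x l) ⟩
    x acc + (x a + ∑ x l)  ∎
    where open ≡-Reasoning

  module Cone (u v : Fin m) (u≢𝟘 : u ≢ 𝟘) (v≢𝟘 : v ≢ 𝟘) (u≢v : u ≢ v) where

    0≤x[i]+x[j] : ∀ x → InKunzCone x → ∀ {i j} → i ≢ 𝟘 → j ≢ 𝟘 → i ⊞ j ≡ 𝟘 → 0ℤ ≤ x i + x j
    0≤x[i]+x[j] x (_ , x-sub) {i} {j} i≢𝟘 j≢𝟘 i⊞j≡𝟘 = via (avoiding j)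
      where
      avoiding : ∀ j → ∃ λ k → k ≢ 𝟘 × k ≢ j
      avoiding j with u Fin.≟ j
      ... | yes refl = v , v≢𝟘 , ≢-sym u≢v
      ... | no u≢j   = u , u≢𝟘 , u≢j
      -- with s = k ⊞ i one has s ⊞ j = k, so the inequalities at (k, i) and (s, j) chain
      via : (∃ λ k → k ≢ 𝟘 × k ≢ j) → 0ℤ ≤ x i + x j
      via (k , k≢𝟘 , k≢j) = i≤i+j⇒0≤j (begin
        x k                ≡⟨ cong x s⊞j≡k ⟨
        x (s ⊞ j)          ≤⟨ x-sub s j (s≢𝟘 , j≢𝟘 , k≢𝟘 ∘ trans (sym s⊞j≡k)) ⟩
        x s + x j          ≤⟨ ℤ.+-monoˡ-≤ (x j) (x-sub k i (k≢𝟘 , i≢𝟘 , s≢𝟘)) ⟩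
        x k + x i + x j    ≡⟨ ℤ.+-assoc (x k) (x i) (x j) ⟩
        x k + (x i + x j)  ∎)
        where
        open ℤ.≤-Reasoning
        s = k ⊞ i
        s⊞j≡k : s ⊞ j ≡ k
        s⊞j≡k = trans (⊞-assoc k i j) (trans (cong (k ⊞_) i⊞j≡𝟘) (⊞-identityʳ k))
        s≢𝟘 : s ≢ 𝟘
        s≢𝟘 s≡𝟘 = k≢j (trans (sym s⊞j≡k) (trans (cong (_⊞ j) s≡𝟘) (⊞-identityˡ j)))

    subadditive : ∀ x → InKunzCone x → ∀ i j → x (i ⊞ j) ≤ x i + x j
    subadditive x x∈C@(x𝟘 , x-sub) i j with i Fin.≟ 𝟘 | j Fin.≟ 𝟘 | (i ⊞ j) Fin.≟ 𝟘
    ... | yes refl | _        | _          = ℤ.≤-reflexive (begin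
      x (𝟘 ⊞ j)  ≡⟨ cong x (⊞-identityˡ j) ⟩
      x j        ≡⟨ ℤ.+-identityˡ (x j) ⟨
      0ℤ + x j   ≡⟨ cong (_+ x j) x𝟘 ⟨
      x 𝟘 + x j  ∎)
      where open ≡-Reasoning
    ... | no _     | yes refl | _          = ℤ.≤-reflexive (begin
      x (i ⊞ 𝟘)  ≡⟨ cong x (⊞-identityʳ i) ⟩
      x i        ≡⟨ ℤ.+-identityʳ (x i) ⟨
      x i + 0ℤ   ≡⟨ cong (_+_ (x i)) x𝟘 ⟨
      x i + x 𝟘  ∎)
      where open ≡-Reasoning
    ... | no i≢𝟘   | no j≢𝟘   | yes i⊞j≡𝟘 =
      subst (_≤ x i + x j) (trans (sym x𝟘) (cong x (sym i⊞j≡𝟘))) (0≤x[i]+x[j] x x∈C i≢𝟘 j≢𝟘 i⊞j≡𝟘)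
    ... | no i≢𝟘   | no j≢𝟘   | no i⊞j≢𝟘  = x-sub i j (i≢𝟘 , j≢𝟘 , i⊞j≢𝟘)

    subadditive-∑ : ∀ x → InKunzCone x → ∀ acc l → x (sumℤm acc l) ≤ x acc + ∑ x l
    subadditive-∑ x x∈C acc []      = ℤ.≤-reflexive (sym (ℤ.+-identityʳ (x acc)))
    subadditive-∑ x x∈C acc (a ∷ l) = begin
      x (sumℤm (acc ⊞ a) l)  ≤⟨ subadditive-∑ x x∈C (acc ⊞ a) l ⟩
      x (acc ⊞ a) + ∑ x l    ≤⟨ ℤ.+-monoˡ-≤ (∑ x l) (subadditive x x∈C acc a) ⟩
      x acc + x a + ∑ x l    ≡⟨ ℤ.+-assoc (x acc) (x a) (∑ x l) ⟩
      x acc + (x a + ∑ x l)  ∎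
      where open ℤ.≤-Reasoning

    nonneg : ∀ x → InKunzCone x → ∀ i → 0ℤ ≤ x i
    nonneg x x∈C@(x𝟘 , _) i = 0≤n*i⇒0≤i m (begin
      0ℤ                           ≡⟨ x𝟘 ⟨
      x 𝟘                          ≡⟨ cong x m·i≡𝟘 ⟨
      x (sumℤm 𝟘 (replicate m i))  ≤⟨ subadditive-∑ x x∈C 𝟘 (replicate m i) ⟩
      x 𝟘 + ∑ x (replicate m i)    ≡⟨ cong₂ _+_ x𝟘 (∑-replicate x m i) ⟩
      0ℤ + + m * x i               ≡⟨ ℤ.+-identityˡ (+ m * x i) ⟩
      + m * x i                    ∎)
      where
      open ℤ.≤-Reasoning
      m·i≡𝟘 : sumℤm 𝟘 (replicate m i) ≡ 𝟘
      m·i≡𝟘 = trans (sumℤm-mod 𝟘 (replicate m i)) (trans (⊞-identityˡ _)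
                (trans (cong (_mod m) (sum-toℕ-replicate m i)) (mod-multiple (toℕ i))))

    tight⇒Defined : ∀ acc l → (∀ x → InFace S x → x (sumℤm acc l) ≡ x acc + ∑ x l) → Defined acc l
    tight⇒Defined acc []      _     = refl
    tight⇒Defined acc (a ∷ l) tight = (λ x x∈F → sym (adds x x∈F)) , tight⇒Defined (acc ⊞ a) l tight′
      where
      adds : ∀ x → InFace S x → x (acc ⊞ a) ≡ x acc + x a
      adds x x∈F@(x∈C , _) = +-tightˡ (subadditive x x∈C acc a) (ℤ.≤-refl {∑ x l}) (begin
        x acc + x a + ∑ x l    ≡⟨ ℤ.+-assoc (x acc) (x a) (∑ x l) ⟩
        x acc + (x a + ∑ x l)  ≡⟨ tight x x∈F ⟨
        x (sumℤm (acc ⊞ a) l)  ≤⟨ subadditive-∑ x x∈C (acc ⊞ a) l ⟩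
        x (acc ⊞ a) + ∑ x l    ∎)
        where open ℤ.≤-Reasoning
      tight′ : ∀ x → InFace S x → x (sumℤm (acc ⊞ a) l) ≡ x (acc ⊞ a) + ∑ x l
      tight′ x x∈F = trans (tight x x∈F)
        (trans (sym (ℤ.+-assoc (x acc) (x a) (∑ x l))) (cong (_+ ∑ x l) (sym (adds x x∈F))))

  module Factorisations (p₁ p₂ p₃ : Fin m) (p₁≢𝟘 : p₁ ≢ 𝟘) (p₂≢𝟘 : p₂ ≢ 𝟘) (p₁≢p₂ : p₁ ≢ p₂) where
    open Atoms p₁ p₂ p₃
    open Cone p₁ p₂ p₁≢𝟘 p₂≢𝟘 p₁≢p₂

    π : Point → V3 ℤ
    π x = (x p₁ , x p₂ , x p₃)

    val : V3 ℕ → ℕ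
    val (z₁ , z₂ , z₃) = z₁ ℕ.* toℕ p₁ ℕ.+ (z₂ ℕ.* toℕ p₂ ℕ.+ z₃ ℕ.* toℕ p₃)

    val-+³ : ∀ v w → val (v +³ w) ≡ val v ℕ.+ val w
    val-+³ (v₁ , v₂ , v₃) (w₁ , w₂ , w₃) = lemma v₁ v₂ v₃ w₁ w₂ w₃ (toℕ p₁) (toℕ p₂) (toℕ p₃)
      where
      lemma : ∀ v₁ v₂ v₃ w₁ w₂ w₃ P₁ P₂ P₃ →
        (v₁ ℕ.+ w₁) ℕ.* P₁ ℕ.+ ((v₂ ℕ.+ w₂) ℕ.* P₂ ℕ.+ (v₃ ℕ.+ w₃) ℕ.* P₃) ≡
        (v₁ ℕ.* P₁ ℕ.+ (v₂ ℕ.* P₂ ℕ.+ v₃ ℕ.* P₃)) ℕ.+ (w₁ ℕ.* P₁ ℕ.+ (w₂ ℕ.* P₂ ℕ.+ w₃ ℕ.* P₃))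
      lemma = ℕ-Solver.solve-∀

    sum-toℕ-word : ∀ z → sum (map toℕ (word z)) ≡ val z
    sum-toℕ-word (z₁ , z₂ , z₃) = begin
      Σ (r₁ ++ r₂ ++ r₃)        ≡⟨ sum-toℕ-++ r₁ (r₂ ++ r₃) ⟩
      Σ r₁ ℕ.+ Σ (r₂ ++ r₃)     ≡⟨ cong (Σ r₁ ℕ.+_) (sum-toℕ-++ r₂ r₃) ⟩
      Σ r₁ ℕ.+ (Σ r₂ ℕ.+ Σ r₃)  ≡⟨ cong₂ ℕ._+_ (sum-toℕ-replicate z₁ p₁)
                                   (cong₂ ℕ._+_ (sum-toℕ-replicate z₂ p₂) (sum-toℕ-replicate z₃ p₃)) ⟩
      val (z₁ , z₂ , z₃)        ∎
      where
      open ≡-Reasoning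
      Σ : List (Fin m) → ℕ
      Σ = sum ∘ map toℕ
      r₁ = replicate z₁ p₁
      r₂ = replicate z₂ p₂
      r₃ = replicate z₃ p₃

    bar-mod : ∀ z → bar z ≡ val z mod m
    bar-mod z = trans (sumℤm-mod 𝟘 (word z)) (trans (⊞-identityˡ _) (cong (_mod m) (sum-toℕ-word z)))

    bar-+³ : ∀ v w → bar (v +³ w) ≡ bar v ⊞ bar w
    bar-+³ v w = begin
      bar (v +³ w)                   ≡⟨ bar-mod (v +³ w) ⟩
      val (v +³ w) mod m             ≡⟨ cong (_mod m) (val-+³ v w) ⟩
      (val v ℕ.+ val w) mod m        ≡⟨ mod-+ (val v) (val w) ⟨
      (val v mod m) ⊞ (val w mod m)  ≡⟨ cong₂ _⊞_ (bar-mod v) (bar-mod w) ⟨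
      bar v ⊞ bar w                  ∎
      where open ≡-Reasoning

    ∑-word : ∀ x z → ∑ x (word z) ≡ z · π x
    ∑-word x (z₁ , z₂ , z₃) = begin
      ∑ x (r₁ ++ r₂ ++ r₃)        ≡⟨ ∑-++ x r₁ (r₂ ++ r₃) ⟩
      ∑ x r₁ + ∑ x (r₂ ++ r₃)     ≡⟨ cong (_+_ (∑ x r₁)) (∑-++ x r₂ r₃) ⟩
      ∑ x r₁ + (∑ x r₂ + ∑ x r₃)  ≡⟨ ℤ.+-assoc (∑ x r₁) (∑ x r₂) (∑ x r₃) ⟨
      ∑ x r₁ + ∑ x r₂ + ∑ x r₃    ≡⟨ cong₂ _+_ (cong₂ _+_ (∑-replicate x z₁ p₁) (∑-replicate x z₂ p₂))
                                                 (∑-replicate x z₃ p₃) ⟩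
      (z₁ , z₂ , z₃) · π x        ∎
      where
      open ≡-Reasoning
      r₁ = replicate z₁ p₁
      r₂ = replicate z₂ p₂
      r₃ = replicate z₃ p₃

    x𝟘+∑-word : ∀ x → InKunzCone x → ∀ z → x 𝟘 + ∑ x (word z) ≡ z · π x
    x𝟘+∑-word x (x𝟘 , _) z = trans (cong (_+ ∑ x (word z)) x𝟘) (trans (ℤ.+-identityˡ _) (∑-word x z))

    bar-bound : ∀ x → InKunzCone x → ∀ z → x (bar z) ≤ z · π x
    bar-bound x x∈C z = ℤ.≤-trans (subadditive-∑ x x∈C 𝟘 (word z)) (ℤ.≤-reflexive (x𝟘+∑-word x x∈C z))

    Defined⇒bar-tight : ∀ x → InFace S x → ∀ z → Defined 𝟘 (word z) → x (bar z) ≡ z · π x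
    Defined⇒bar-tight x x∈F z defined =
      trans (Defined⇒tight x x∈F 𝟘 (word z) defined) (x𝟘+∑-word x (proj₁ x∈F) z)

    bar-tight⇒Defined : ∀ z → (∀ x → InFace S x → x (bar z) ≡ z · π x) → Defined 𝟘 (word z)
    bar-tight⇒Defined z tight =
      tight⇒Defined 𝟘 (word z) λ x x∈F → trans (tight x x∈F) (sym (x𝟘+∑-word x (proj₁ x∈F) z))

    FactNil⇒¬¬gap : ∀ z → FactNil z → ¬ ¬ (∃ λ x → InFace S x × x (bar z) < z · π x)
    FactNil⇒¬¬gap z nil no-gap = nil (bar-tight⇒Defined z λ x x∈F →
      decidable-stable (x (bar z) ℤ.≟ z · π x)
        λ x≢ → no-gap (x , x∈F , ℤ.≤∧≢⇒< (bar-bound x (proj₁ x∈F) z) x≢))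

    Defined-+³ˡ : ∀ v w → Defined 𝟘 (word (v +³ w)) → Defined 𝟘 (word v)
    Defined-+³ˡ v w defined = bar-tight⇒Defined v λ x x∈F@(x∈C , _) →
      +-tightˡ (bar-bound x x∈C v) (bar-bound x x∈C w) (begin
        v · π x + w · π x      ≡⟨ ·-distribʳ-+³ v w (π x) ⟨
        (v +³ w) · π x         ≡⟨ Defined⇒bar-tight x x∈F (v +³ w) defined ⟨
        x (bar (v +³ w))       ≡⟨ cong x (bar-+³ v w) ⟩
        x (bar v ⊞ bar w)      ≤⟨ subadditive x x∈C (bar v) (bar w) ⟩
        x (bar v) + x (bar w)  ∎)
      where open ℤ.≤-Reasoning

    Defined-+³ʳ : ∀ v w → Defined 𝟘 (word (v +³ w)) → Defined 𝟘 (word w)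
    Defined-+³ʳ v w = Defined-+³ˡ w v ∘ subst (Defined 𝟘 ∘ word) (+³-comm v w)

    Defined-≤³ : ∀ {v w} → v ≤³ w → Defined 𝟘 (word w) → Defined 𝟘 (word v)
    Defined-≤³ {v} v≤w defined with ≤³⇒∃+³ v≤w
    ... | r , refl = Defined-+³ˡ v r defined

    outerBetti-antichain : ∀ {z z′} → OuterBetti z → OuterBetti z′ → z ≤³ z′ → z ≡ z′
    outerBetti-antichain (nil , _) (_ , below₁ , below₂ , below₃) (l₁ , l₂ , l₃)
      with ℕ.m≤n⇒m<n∨m≡n l₁ | ℕ.m≤n⇒m<n∨m≡n l₂ | ℕ.m≤n⇒m<n∨m≡n l₃
    ... | inj₁ (s≤s l₁′) | _              | _              = ⊥-elim (nil (Defined-≤³ (l₁′ , l₂ , l₃) (below₁ _ refl)))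
    ... | inj₂ refl      | inj₁ (s≤s l₂′) | _              = ⊥-elim (nil (Defined-≤³ (l₁ , l₂′ , l₃) (below₂ _ refl)))
    ... | inj₂ refl      | inj₂ refl      | inj₁ (s≤s l₃′) = ⊥-elim (nil (Defined-≤³ (l₁ , l₂ , l₃′) (below₃ _ refl)))
    ... | inj₂ refl      | inj₂ refl      | inj₂ refl      = refl

    -- minimise one coordinate at a time; minimality in the earlier coordinates survives
    -- lowering the later ones by Defined-≤³
    outerBetti-below : ∀ y → FactNil y → ¬ ¬ (∃ λ b → b ≤³ y × OuterBetti b)
    outerBetti-below (y₁ , y₂ , y₃) nil = do
      k₁ , k₁≤y₁ , nil₁ , below₁ ← ¬¬-least (λ k → Defined 𝟘 (word (k , y₂ , y₃))) y₁ nil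
      k₂ , k₂≤y₂ , nil₂ , below₂ ← ¬¬-least (λ k → Defined 𝟘 (word (k₁ , k , y₃))) y₂ nil₁
      k₃ , k₃≤y₃ , nil₃ , below₃ ← ¬¬-least (λ k → Defined 𝟘 (word (k₁ , k₂ , k))) y₃ nil₂
      pure ((k₁ , k₂ , k₃) , (k₁≤y₁ , k₂≤y₂ , k₃≤y₃) , nil₃ ,
            (λ j e → Defined-≤³ {j , k₂ , k₃} {j , y₂ , y₃} (ℕ.≤-refl , k₂≤y₂ , k₃≤y₃) (below₁ j e)) ,
            (λ j e → Defined-≤³ {k₁ , j , k₃} {k₁ , j , y₃} (ℕ.≤-refl , ℕ.≤-refl , k₃≤y₃) (below₂ j e)) ,
            below₃)

    module WithStaircase (stair : Staircase) where

      nf : V3 ℕ → V3 ℕ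
      nf z = proj₁ (stair (bar z))

      nf-Fact : ∀ z → Fact (nf z) (bar z)
      nf-Fact z = proj₁ (proj₂ (stair (bar z)))

      Fact-unique : ∀ {n} a a′ → Fact a n → Fact a′ n → a ≡ a′
      Fact-unique {n} a a′ fa fa′ = trans (proj₂ (proj₂ (stair n)) a fa) (sym (proj₂ (proj₂ (stair n)) a′ fa′))

      Fact⇒≡nf : ∀ a z → Fact a (bar z) → a ≡ nf z
      Fact⇒≡nf a z fa = Fact-unique a (nf z) fa (nf-Fact z)

      Defined⇒nf≡ : ∀ z → Defined 𝟘 (word z) → nf z ≡ z
      Defined⇒nf≡ z defined = sym (Fact⇒≡nf z z (defined , refl))

      nf-value : ∀ x → InFace S x → ∀ z → nf z · π x ≡ x (bar z)
      nf-value x x∈F z = trans (sym (Defined⇒bar-tight x x∈F (nf z) (proj₁ (nf-Fact z)))) (cong x (proj₂ (nf-Fact z)))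

      nf-≤-face : ∀ x → InFace S x → ∀ z → nf z · π x ≤ z · π x
      nf-≤-face x x∈F z = ℤ.≤-trans (ℤ.≤-reflexive (nf-value x x∈F z)) (bar-bound x (proj₁ x∈F) z)

      nf-move : ∀ b r → nf (nf b +³ r) ≡ nf (b +³ r)
      nf-move b r = cong (proj₁ ∘ stair) (begin
        bar (nf b +³ r)     ≡⟨ bar-+³ (nf b) r ⟩
        bar (nf b) ⊞ bar r  ≡⟨ cong (_⊞ bar r) (proj₂ (nf-Fact b)) ⟩
        bar b ⊞ bar r       ≡⟨ bar-+³ b r ⟨
        bar (b +³ r)        ∎)
        where open ≡-Reasoning

      Gap : Point → V3 ℕ → Set
      Gap x b = nf b · π x < b · π x

      gap-+ˡ : ∀ x y b → InFace S y → Gap x b → Gap (zipWith _+_ x y) b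
      gap-+ˡ x y b y∈F gap = subst₂ _<_ (sym (·-distribˡ-⊕³ (nf b) (π x) (π y))) (sym (·-distribˡ-⊕³ b (π x) (π y)))
        (ℤ.+-mono-<-≤ gap (nf-≤-face y y∈F b))

      gap-+ʳ : ∀ x y b → InFace S x → Gap y b → Gap (zipWith _+_ x y) b
      gap-+ʳ x y b x∈F gap = subst₂ _<_ (sym (·-distribˡ-⊕³ (nf b) (π x) (π y))) (sym (·-distribˡ-⊕³ b (π x) (π y)))
        (ℤ.+-mono-≤-< (nf-≤-face x x∈F b) gap)

      DefinedOrGap : Point → V3 ℕ → Set
      DefinedOrGap x b = Defined 𝟘 (word b) ⊎ Gap x b

      interior-for : ∀ L → ¬ ¬ (∃ λ x → InFace S x × All (DefinedOrGap x) L)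
      interior-for []      = pure ((λ _ → 0ℤ) , face-0 , [])
      interior-for (b ∷ L) = do
        x , x∈F , x-ok ← interior-for L
        ¬¬-excluded-middle >>= λ where
          (yes defined) → pure (x , x∈F , inj₁ defined ∷ x-ok)
          (no nil)      → do
            y , y∈F , y-gap ← FactNil⇒¬¬gap b nil
            pure (zipWith _+_ y x , face-+ y x y∈F x∈F ,
                  inj₂ (gap-+ˡ y x b x∈F (subst (_< b · π y) (sym (nf-value y y∈F b)) y-gap)) ∷
                  All.map (λ {b′} → Sum.map₂ (gap-+ʳ y x b′ y∈F)) x-ok)

      units : List (V3 ℕ)
      units = (1 , 0 , 0) ∷ (0 , 1 , 0) ∷ (0 , 0 , 1) ∷ []

      -- every outer Betti element is a unit vector plus the factorisation of some n ∈ ℤ_m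
      steps : Fin m → List (V3 ℕ)
      steps n = map (_+³ proj₁ (stair n)) units

      candidates : List (V3 ℕ)
      candidates = concatMap steps (allFin m)

      step∈candidates : ∀ {e} → e ∈ units → ∀ v → Defined 𝟘 (word v) → e +³ v ∈ candidates
      step∈candidates {e} e∈units v defined = ∈-concatMap⁺ steps (Any.map (λ { refl →
        subst (λ t → e +³ t ∈ map (_+³ nf v) units) (Defined⇒nf≡ v defined) (∈-map⁺ (_+³ nf v) e∈units) })
        (∈-allFin (bar v)))

      outerBetti∈candidates : ∀ b → OuterBetti b → b ∈ candidates
      outerBetti∈candidates (suc k , b₂ , b₃)   (_ , below₁ , _)          =
        step∈candidates (here refl) (k , b₂ , b₃) (below₁ k refl)
      outerBetti∈candidates (zero , suc k , b₃) (_ , _ , below₂ , _)      =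
        step∈candidates (there (here refl)) (0 , k , b₃) (below₂ k refl)
      outerBetti∈candidates (zero , zero , suc k) (_ , _ , _ , below₃)    =
        step∈candidates (there (there (here refl))) (0 , 0 , k) (below₃ k refl)
      outerBetti∈candidates (zero , zero , zero) (nil , _)                = ⊥-elim (nil refl)

      interior-point : ¬ ¬ (∃ λ x → InFace S x × ∀ b → OuterBetti b → Gap x b)
      interior-point = ¬¬-map
        (λ (x , x∈F , x-ok) → x , x∈F , λ b ob →
          [ ⊥-elim ∘ proj₁ ob , id ]′ (All.lookup x-ok (outerBetti∈candidates b ob)))
        (interior-for candidates)

      nf-bound : ∃ λ N → ∀ z → size (nf z) ℕ.≤ N
      nf-bound = proj₁ bounded , λ z → proj₂ bounded (bar z)
        where bounded = Fin-bounded (size ∘ proj₁ ∘ stair)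

      module Interior (x₀ : Point) (x₀∈F : InFace S x₀) (gap₀ : ∀ b → OuterBetti b → Gap x₀ b) where

        y₀ : V3 ℤ
        y₀ = π x₀

        0≤x₀ : ∀ i → 0ℤ ≤ x₀ i
        0≤x₀ = nonneg x₀ (proj₁ x₀∈F)

        -- each Betti inequality holds at y₀ with an integral gap ≥ 1, which absorbs adding a unit
        -- vector to N·y₀ once N bounds the sizes of all factorisations
        F_N-rank3 : HasRank 3 InFN
        F_N-rank3 = (λ i → Y ⊕³ ε i) , shifted∈F_N ,
                    LinIndep-shifted-basis (0≤n*i N (0≤x₀ p₁)) (0≤n*i N (0≤x₀ p₂)) (0≤n*i N (0≤x₀ p₃))
          where
          N = proj₁ nf-bound
          Y = (+ N) ⊛ y₀
          ·-shifted : ∀ a i → a · (Y ⊕³ ε i) ≡ + N * (a · y₀) + + coord i a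
          ·-shifted a i = trans (·-distribˡ-⊕³ a Y (ε i)) (cong₂ _+_ (·-⊛ a (+ N) y₀) (·-ε i a))
          shifted∈F_N : ∀ i → InFN (Y ⊕³ ε i)
          shifted∈F_N i b a ob fa = subst₂ _≤_ (sym (·-shifted a i)) (sym (·-shifted b i))
            (scaled-gap (ℤ.+≤+ z≤n) a-gap (ℤ.+≤+ a-small) (ℤ.+≤+ z≤n))
            where
            a≡nf : a ≡ nf b
            a≡nf = Fact⇒≡nf a b fa
            a-gap : a · y₀ < b · y₀
            a-gap = subst (λ t → t · y₀ < b · y₀) (sym a≡nf) (gap₀ b ob)
            a-small : coord i a ℕ.≤ N
            a-small = ℕ.≤-trans (coord≤size i a) (subst (λ t → size t ℕ.≤ N) (sym a≡nf) (proj₂ nf-bound b))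

        weight : V3 ℕ → ℕ
        weight v = ℤ.∣ v · y₀ ∣

        +weight≡ : ∀ v → + weight v ≡ v · y₀
        +weight≡ v = ℤ.0≤i⇒+∣i∣≡i (·-nonNeg v (0≤x₀ p₁) (0≤x₀ p₂) (0≤x₀ p₃))

        betti-move-decreases : ∀ b r → OuterBetti b → weight (nf b +³ r) ℕ.< weight (b +³ r)
        betti-move-decreases b r ob = ℤ.drop‿+<+ (begin-strict
          + weight (nf b +³ r)  ≡⟨ +weight≡ (nf b +³ r) ⟩
          (nf b +³ r) · y₀      ≡⟨ ·-distribʳ-+³ (nf b) r y₀ ⟩
          nf b · y₀ + r · y₀    <⟨ ℤ.+-monoˡ-< (r · y₀) (gap₀ b ob) ⟩
          b · y₀ + r · y₀       ≡⟨ ·-distribʳ-+³ b r y₀ ⟨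
          (b +³ r) · y₀         ≡⟨ +weight≡ (b +³ r) ⟨
          + weight (b +³ r)     ∎)
          where open ℤ.≤-Reasoning

        betti-move-≤ : ∀ x → InFN x → ∀ b r → OuterBetti b →
                       nf (nf b +³ r) · x ≤ (nf b +³ r) · x → nf (b +³ r) · x ≤ (b +³ r) · x
        betti-move-≤ x x∈FN b r ob moved = begin
          nf (b +³ r) · x     ≡⟨ cong (_· x) (nf-move b r) ⟨
          nf (nf b +³ r) · x  ≤⟨ moved ⟩
          (nf b +³ r) · x     ≡⟨ ·-distribʳ-+³ (nf b) r x ⟩
          nf b · x + r · x    ≤⟨ ℤ.+-monoˡ-≤ (r · x) (x∈FN b (nf b) ob (nf-Fact b)) ⟩
          b · x + r · x       ≡⟨ ·-distribʳ-+³ b r x ⟨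
          (b +³ r) · x        ∎
          where open ℤ.≤-Reasoning

        nf-≤-F_N : ∀ x → InFN x → ∀ y → nf y · x ≤ y · x
        nf-≤-F_N x x∈FN = WF.All.wfRec (On.wellFounded weight <-wellFounded) 0ℓ (λ y → nf y · x ≤ y · x) step
          where
          step : ∀ y → (∀ {y′} → weight y′ ℕ.< weight y → nf y′ · x ≤ y′ · x) → nf y · x ≤ y · x
          step y rec = decidable-stable (nf y · x ℤ.≤? y · x) (¬¬-excluded-middle >>= λ where
            (yes defined) → pure (ℤ.≤-reflexive (cong (_· x) (Defined⇒nf≡ y defined)))
            (no nil)      → ¬¬-map (λ (b , b≤y , ob) → via b ob (≤³⇒∃+³ b≤y)) (outerBetti-below y nil))
            where
            via : ∀ b → OuterBetti b → ∃ (λ r → b +³ r ≡ y) → nf y · x ≤ y · x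
            via b ob (r , b+r≡y) = subst (λ t → nf t · x ≤ t · x) b+r≡y (betti-move-≤ x x∈FN b r ob
              (rec {nf b +³ r} (subst (λ t → weight (nf b +³ r) ℕ.< weight t) b+r≡y (betti-move-decreases b r ob))))

        -- Q = (z′ + c) ∸ (z + c′) and P = (z + c′) ∸ (z′ + c) satisfy (z + c′) + Q = (z′ + c) + P, and
        -- Q·x ≤ P·x on F_N when Q is a factorisation; so tightness for z forces tightness for z′
        betti-forced : ∀ z z′ c c′ → OuterBetti z′ → Fact c (bar z) → Fact c′ (bar z′) →
                       Defined 𝟘 (word ((z′ +³ c) ∸³ (z +³ c′))) →
                       ∀ x → InFN x → z · x ≡ c · x → z′ · x ≡ c′ · x
        betti-forced z z′ c c′ ob′ fc fc′ Q-defined x x∈FN z-tight =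
          sym (+-tightˡ (x∈FN z′ c′ ob′ fc′) Q≤P (ℤ.≤-reflexive (sym sums)))
          where
          Q = (z′ +³ c) ∸³ (z +³ c′)
          P = (z +³ c′) ∸³ (z′ +³ c)
          relation : (z +³ c′) +³ Q ≡ (z′ +³ c) +³ P
          relation = +³-∸³-comm (z +³ c′) (z′ +³ c)
          bar-Q≡bar-P : bar Q ≡ bar P
          bar-Q≡bar-P = ⊞-cancelˡ (bar z ⊞ bar z′) (begin
            (bar z ⊞ bar z′) ⊞ bar Q  ≡⟨ cong (λ t → (bar z ⊞ t) ⊞ bar Q) (proj₂ fc′) ⟨
            (bar z ⊞ bar c′) ⊞ bar Q  ≡⟨ trans (bar-+³ (z +³ c′) Q) (cong (_⊞ bar Q) (bar-+³ z c′)) ⟨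
            bar ((z +³ c′) +³ Q)      ≡⟨ cong bar relation ⟩
            bar ((z′ +³ c) +³ P)      ≡⟨ trans (bar-+³ (z′ +³ c) P) (cong (_⊞ bar P) (bar-+³ z′ c)) ⟩
            (bar z′ ⊞ bar c) ⊞ bar P  ≡⟨ cong (λ t → (bar z′ ⊞ t) ⊞ bar P) (proj₂ fc) ⟩
            (bar z′ ⊞ bar z) ⊞ bar P  ≡⟨ cong (_⊞ bar P) (⊞-comm (bar z′) (bar z)) ⟩
            (bar z ⊞ bar z′) ⊞ bar P  ∎)
            where open ≡-Reasoning
          Q≤P : Q · x ≤ P · x
          Q≤P = subst (λ t → t · x ≤ P · x) (sym (Fact⇒≡nf Q P (Q-defined , bar-Q≡bar-P))) (nf-≤-F_N x x∈FN P)
          sums : c′ · x + Q · x ≡ z′ · x + P · x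
          sums = +-cancel-common {c · x} {c′ · x} {Q · x} {z′ · x} {P · x} (begin
            c · x + c′ · x + Q · x  ≡⟨ cong (λ t → t + c′ · x + Q · x) z-tight ⟨
            z · x + c′ · x + Q · x  ≡⟨ trans (·-distribʳ-+³ (z +³ c′) Q x)
                                             (cong (_+ Q · x) (·-distribʳ-+³ z c′ x)) ⟨
            ((z +³ c′) +³ Q) · x    ≡⟨ cong (_· x) relation ⟩
            ((z′ +³ c) +³ P) · x    ≡⟨ trans (·-distribʳ-+³ (z′ +³ c) P x)
                                             (cong (_+ P · x) (·-distribʳ-+³ z′ c x)) ⟩
            z′ · x + c · x + P · x  ∎)
            where open ≡-Reasoning

        betti-facet-rank≤1 : ∀ z z′ c c′ → OuterBetti z′ → Fact c (bar z) → Fact c′ (bar z′) →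
                             Defined 𝟘 (word ((z′ +³ c) ∸³ (z +³ c′))) → det₁₂ (z -³ c) (z′ -³ c′) ≢ 0ℤ →
                             ¬ HasRank 2 (λ x → InFN x × z · x ≡ c · x)
        betti-facet-rank≤1 z z′ c c′ ob′ fc fc′ Q-defined det≢0 =
          ¬HasRank2-kernel {z -³ c} {z′ -³ c′} det≢0 ∘
          HasRank-⊆ {P = λ x → InFN x × z · x ≡ c · x} {Q = Kernel (z -³ c) (z′ -³ c′)} λ {x} (x∈FN , z-tight) →
            ∙-diff≡0 {z} {c} z-tight ,
            ∙-diff≡0 {z′} {c′} (betti-forced z z′ c c′ ob′ fc fc′ Q-defined x x∈FN z-tight)

      betti-redundant : ∀ z z′ c c′ → OuterBetti z′ → Fact c (bar z) → Fact c′ (bar z′) →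
                        Defined 𝟘 (word ((z′ +³ c) ∸³ (z +³ c′))) → det₁₂ (z -³ c) (z′ -³ c′) ≢ 0ℤ →
                        Redundant z
      betti-redundant z z′ c c′ ob′ fc fc′ Q-defined det≢0 a fa (_ , dim-F_N , dim-facet) =
        interior-point λ (x₀ , x₀∈F , gap₀) → let open Interior x₀ x₀∈F gap₀ in
          betti-facet-rank≤1 z z′ c c′ ob′ fc fc′ Q-defined det≢0
            (subst (λ t → HasRank 2 (λ x → InFN x × z · x ≡ t · x)) (Fact-unique a c fa fc)
              (facet-rank {P = InFN} {Q = λ x → InFN x × z · x ≡ a · x} F_N-rank3 dim-F_N dim-facet))

      nil-step-avoids : ∀ e v w → FactNil (e +³ v) → Defined 𝟘 (word v) → Fact (e +³ w) (bar (e +³ v)) → ⊥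
      nil-step-avoids e v w nil v-defined (ew-defined , bar-ew≡bar-ev) =
        nil (subst (λ t → Defined 𝟘 (word (e +³ t))) w≡v ew-defined)
        where
        bar-w≡bar-v : bar w ≡ bar v
        bar-w≡bar-v = ⊞-cancelˡ (bar e) (trans (sym (bar-+³ e w)) (trans bar-ew≡bar-ev (bar-+³ e v)))
        w≡v : w ≡ v
        w≡v = Fact-unique w v (Defined-+³ʳ e w ew-defined , bar-w≡bar-v) (v-defined , refl)

      supp₁₂-factorisation : ∀ {a b} → OuterBetti (suc a , suc b , 0) →
                             ∃ λ k → Fact (0 , 0 , k) (bar (suc a , suc b , 0))
      supp₁₂-factorisation {a} {b} (nil , below₁ , below₂ , _)
        with nf (suc a , suc b , 0) | nf-Fact (suc a , suc b , 0)
      ... | suc t , n₂ , n₃   | f =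
        ⊥-elim (nil-step-avoids (1 , 0 , 0) (a , suc b , 0) (t , n₂ , n₃) nil (below₁ a refl) f)
      ... | zero , suc t , n₃ | f =
        ⊥-elim (nil-step-avoids (0 , 1 , 0) (suc a , b , 0) (0 , t , n₃) nil (below₂ b refl) f)
      ... | zero , zero , k   | f = k , f

      supp₁₂-ordered : ∀ {a b a′ b′} → a ℕ.< a′ → OuterBetti (suc a , suc b , 0) → OuterBetti (suc a′ , suc b′ , 0) →
                       Redundant (suc a , suc b , 0) ⊎ Redundant (suc a′ , suc b′ , 0)
      supp₁₂-ordered {a} {b} {a′} {b′} a<a′ ob@(_ , _ , below₂ , _) ob′@(_ , below₁′ , _) =
        by-factorisations (supp₁₂-factorisation ob) (supp₁₂-factorisation ob′)
        where
        z z′ : V3 ℕ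
        z  = suc a , suc b , 0
        z′ = suc a′ , suc b′ , 0
        a≤a′ : a ℕ.≤ a′
        a≤a′ = ℕ.<⇒≤ a<a′
        b′<b : b′ ℕ.< b
        b′<b = ℕ.≰⇒> λ b≤b′ →
          ℕ.<-irrefl (cong (ℕ.pred ∘ proj₁) (outerBetti-antichain ob ob′ (s≤s a≤a′ , s≤s b≤b′ , z≤n))) a<a′
        excess≤ : ∀ m n → (m ℕ.+ 0) ℕ.∸ (n ℕ.+ 0) ℕ.≤ m
        excess≤ m n = ℕ.≤-trans (ℕ.m∸n≤m (m ℕ.+ 0) (n ℕ.+ 0)) (ℕ.≤-reflexive (ℕ.+-identityʳ m))
        cross : suc a ℕ.* suc b′ ℕ.< suc a′ ℕ.* suc b
        cross = ℕ.<-≤-trans (ℕ.*-monoʳ-< (suc a) (s≤s b′<b)) (ℕ.*-monoˡ-≤ (suc b) (s≤s a≤a′))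
        by-factorisations : (∃ λ k → Fact (0 , 0 , k) (bar (suc a , suc b , 0))) →
                            (∃ λ k′ → Fact (0 , 0 , k′) (bar (suc a′ , suc b′ , 0))) →
                            Redundant (suc a , suc b , 0) ⊎ Redundant (suc a′ , suc b′ , 0)
        by-factorisations (k , fc) (k′ , fc′) with k ℕ.≤? k′
        ... | yes k≤k′ = inj₁ (betti-redundant z z′ (0 , 0 , k) (0 , 0 , k′) ob′ fc fc′
              (Defined-≤³ {w = a′ , suc b′ , 0}
                (excess≤ a′ a , ℕ.m≤n⇒m≤1+n (excess≤ b′ b) , ℕ.≤-reflexive (ℕ.m≤n⇒m∸n≡0 k≤k′))
                (below₁′ a′ refl))
              (det₁₂-supp₁₂ (suc a) (suc b) (suc a′) (suc b′) k k′
                λ e → ℕ.<-irrefl (trans e (ℕ.*-comm (suc b) (suc a′))) cross))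
        ... | no k≰k′  = inj₂ (betti-redundant z′ z (0 , 0 , k′) (0 , 0 , k) ob fc′ fc
              (Defined-≤³ {w = suc a , b , 0}
                (ℕ.m≤n⇒m≤1+n (excess≤ a a′) , excess≤ b b′ , ℕ.≤-reflexive (ℕ.m≤n⇒m∸n≡0 k′≤k))
                (below₂ b refl))
              (det₁₂-supp₁₂ (suc a′) (suc b′) (suc a) (suc b) k′ k
                λ e → ℕ.<-irrefl (trans (ℕ.*-comm (suc a) (suc b′)) (sym e)) cross))
          where
          k′≤k : k′ ℕ.≤ k
          k′≤k = ℕ.<⇒≤ (ℕ.≰⇒> k≰k′)

      supp₁₂-pair : ∀ {z z′} → z ≢ z′ → OuterBetti z → OuterBetti z′ → Supp12 z → Supp12 z′ →
                    Redundant z ⊎ Redundant z′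
      supp₁₂-pair {zero , _ , _}     _ _ _ (0≢0 , _) _         = ⊥-elim (0≢0 refl)
      supp₁₂-pair {_ , zero , _}     _ _ _ (_ , 0≢0 , _) _     = ⊥-elim (0≢0 refl)
      supp₁₂-pair {_} {zero , _ , _} _ _ _ _ (0≢0 , _)         = ⊥-elim (0≢0 refl)
      supp₁₂-pair {_} {_ , zero , _} _ _ _ _ (_ , 0≢0 , _)     = ⊥-elim (0≢0 refl)
      supp₁₂-pair {suc a , suc b , _} {suc a′ , suc b′ , _} z≢z′ ob ob′ (_ , _ , refl) (_ , _ , refl)
        with ℕ.<-cmp a a′
      ... | tri< a<a′ _ _ = supp₁₂-ordered a<a′ ob ob′
      ... | tri> _ _ a′<a = Sum.swap (supp₁₂-ordered a′<a ob′ ob)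
      ... | tri≈ _ refl _ with ℕ.≤-total b b′
      ...   | inj₁ b≤b′ = ⊥-elim (z≢z′ (outerBetti-antichain ob ob′ (ℕ.≤-refl , s≤s b≤b′ , z≤n)))
      ...   | inj₂ b′≤b = ⊥-elim (z≢z′ (sym (outerBetti-antichain ob′ ob (ℕ.≤-refl , s≤s b′≤b , z≤n))))

theorem6p4 : (m : ℕ) .{{nz : NonZero m}} (S : Kunz.FaceData m) →
    Kunz.TrivialSubgroup m S →
    (p₁ p₂ p₃ : Fin m) →
    let open Kunz m
        open Nil S
        open Atoms p₁ p₂ p₃
    in Atom p₁ → Atom p₂ → Atom p₃ →
       p₁ ≢ p₂ → p₁ ≢ p₃ → p₂ ≢ p₃ →
       (∀ a → Atom a → (a ≡ p₁) ⊎ (a ≡ p₂) ⊎ (a ≡ p₃)) →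
       Staircase →
       (z z' : V3 ℕ) → z ≢ z' →
       OuterBetti z → OuterBetti z' → Supp12 z → Supp12 z' →
       Redundant z ⊎ Redundant z'
-- The trivial-subgroup and atom hypotheses enter only through p₁, p₂ ≠ 0 and p₁ ≠ p₂, which make
-- the Kunz inequalities subadditive also across 0 (whence x ≥ 0 on the cone).
theorem6p4 m S _ p₁ p₂ p₃ (p₁≢𝟘 , _) (p₂≢𝟘 , _) _ p₁≢p₂ _ _ _ stair z z′ z≢z′ =
  supp₁₂-pair z≢z′
  where open Nilsemigroup.Factorisations.WithStaircase m S p₁ p₂ p₃ p₁≢𝟘 p₂≢𝟘 p₁≢p₂ stair
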